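{- Assume Dickson's conjecture. Then there are infinitely many positive integers $n$ such that $$r(n,n)\ge \frac98-\frac{9}{8n}.$$
   Context: $\phi$ denotes Euler's totient function. For positive integers $a,b$, $c(a,b)$ is defined as the least positive integer $c$ such that $\phi(a!)\phi(b!)$ divides $\phi(c!)$, and $r(a,b)=c(a,b)/(a+b)$. Dickson's conjecture is the following hypothesis: for any integers $a_1,\dots,a_k$ and positive integers $b_1,\dots,b_k$, there are infinitely many positive integers $n$ for which all of $a_1+b_1n,\dots,a_k+b_kn$ are prime, unless there exists a prime $q$ such that the product $(a_1+b_1n)\cdots(a_k+b_kn)$ is divisible by $q$ for every $n\in\{0,1,\dots,q-1\}$. -}

module Defs where

open import Data.Nat using (ℕ; zero; suc; _+_; _*_; _≤_; _<_; _!)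
open import Data.Nat.GCD using (gcd)

open import Data.Nat.Primality using (Prime)
open import Data.Nat.Divisibility using (_∣_)
open import Data.Nat.Properties using (_≟_)
open import Data.Integer as ℤ using (ℤ; +_)
import Data.Integer.Divisibility as ℤD
open import Data.Fin using (Fin; zero; suc)
open import Data.List using (List; length; filter; map; upTo)
open import Data.Product using (Σ; ∃; ∃-syntax; _×_)
open import Relation.Nullary using (¬_)
open import Relation.Binary.PropositionalEquality using (_≡_)

φ : ℕ → ℕ
φ n = length (filter (λ k → gcd k n ≟ 1) (map suc (upTo n)))

IsC : ℕ → ℕ → ℕ → Set
IsC a b c =
  1 ≤ c × (φ (a !) * φ (b !) ∣ φ (c !)) ×
  (∀ c′ → 1 ≤ c′ → c′ < c → ¬ (φ (a !) * φ (b !) ∣ φ (c′ !)))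

prodℤ : (k : ℕ) → (Fin k → ℤ) → ℤ
prodℤ zero f = + 1
prodℤ (suc k) f = f zero ℤ.* prodℤ k (λ i → f (suc i))

Dickson : Set
Dickson =
  (k : ℕ) (a : Fin k → ℤ) (b : Fin k → ℕ) → (∀ i → 1 ≤ b i) →
  ¬ (∃[ q ] (Prime q × (∀ n → n < q →
        (+ q) ℤD.∣ prodℤ k (λ i → a i ℤ.+ (+ b i) ℤ.* (+ n))))) →
  ∀ N → ∃[ n ] (N < n ×
        (∀ i → ∃[ p ] (Prime p × (a i ℤ.+ (+ b i) ℤ.* (+ n) ≡ + p))))

-- Write φ(n!) = ρ(0) ρ(1) ⋯ ρ(n - 1), where ρ(y) = y if y + 1 is prime and ρ(y) = y + 1
-- otherwise: φ(q x) = (q - 1) φ(x) for a prime q ∤ x, and φ(c x) = c φ(x) when every prime factor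
-- of c divides x. For a prime p, the p-adic valuation of φ(c!) is then the number of y < c with
-- p ∣ ρ(y), provided no ρ(y) is divisible by p². Take p = 11 + 210 t with 2p + 1, 6p + 1, 8p + 1
-- prime (Dickson's conjecture gives infinitely many such t); the residues of p modulo 2, 3, 5, 7
-- make every other j p + 1 with j < 18 composite. The y with p ∣ ρ(y) and y < 18p are then
-- y + 1 ∈ {2p, …, 17p, 2p + 1, 6p + 1, 8p + 1}, so p¹⁰ ∣ φ((8p + 1)!) while p²⁰ ∤ φ(c!) for
-- c < 18p. Hence n = 8p + 1 has c(n, n) ≥ 18p, i.e. r(n, n) ≥ 18p / (16p + 2) = 9/8 - 9/(8n).

module Submission where

open import Defs
open import Data.Nat using (ℕ; suc; _+_; _*_; _≤_)
open import Data.Integer using (+_)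
open import Data.Rational using (ℚ; _/_; _-_)
import Data.Rational as ℚ
open import Data.Product using (_×_; ∃-syntax)

open import Data.Nat using (zero; _<_; _^_; _∸_; _!; _≤?_; _≟_; NonZero; >-nonZero; >-nonZero⁻¹;
  n>1⇒nonTrivial; nonTrivial⇒n>1; z≤n; s≤s; z<s; sz<ss)
open import Data.Nat.Properties
open import Data.Nat.Divisibility
open import Data.Nat.Coprimality as Coprime
  using (Coprime; coprime?; coprime⇒gcd≡1; gcd≡1⇒coprime; coprime-+; coprime-divisor)
open import Data.Nat.GCD using (gcd)
open import Data.Nat.Primality
open import Data.Nat.Tactic.RingSolver using (solve-∀)
open import Data.Integer as ℤ using (ℤ)
import Data.Integer.Properties as ℤP
import Data.Integer.Divisibility as ℤD
open import Data.Rational using (0ℚ)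
import Data.Rational.Properties as ℚP
import Data.Rational.Unnormalised as ℚᵘ
import Data.Rational.Unnormalised.Properties as ℚᵘP
open import Data.Fin using (Fin; zero; suc)
open import Data.List using (List; []; _∷_; _++_; length; filter; map; upTo; applyUpTo)
open import Data.List.Properties using (map-applyUpTo)
open import Data.List.Membership.Propositional using (_∈_)
open import Data.List.Membership.Propositional.Properties using (∈-++⁺ˡ; ∈-++⁺ʳ; ∈-map⁺; ∈-applyUpTo⁺)
open import Data.List.Relation.Unary.Any using (here; there)
open import Data.Product using (_,_)
open import Data.Sum using (inj₁; inj₂)
open import Data.Empty using (⊥-elim)
open import Function using (_∘_; id)
open import Relation.Nullary using (Dec; yes; no; ¬_; contradiction)
open import Relation.Unary using (Decidable)
open import Relation.Binary.PropositionalEquality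
open import Algebra.Properties.CommutativeSemigroup +-commutativeSemigroup
  using () renaming (interchange to +-interchange)

private variable
  a b c d k m n p q x y z : ℕ

indicator : {A : Set} → Dec A → ℕ
indicator (yes _) = 1
indicator (no _) = 0

indicator-cong : {A B : Set} → (A → B) → (B → A) → (A? : Dec A) (B? : Dec B) → indicator A? ≡ indicator B?
indicator-cong f g (yes _) (yes _) = refl
indicator-cong f g (yes a) (no ¬b) = contradiction (f a) ¬b
indicator-cong f g (no ¬a) (yes b) = contradiction (g b) ¬a
indicator-cong f g (no _) (no _) = refl

indicator-mono : {A B : Set} → (A → B) → (A? : Dec A) (B? : Dec B) → indicator A? ≤ indicator B?
indicator-mono f (yes a) (yes _) = ≤-refl
indicator-mono f (yes a) (no ¬b) = contradiction (f a) ¬b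
indicator-mono f (no _)  _       = z≤n

indicator≤1 : {A : Set} (A? : Dec A) → indicator A? ≤ 1
indicator≤1 (yes _) = ≤-refl
indicator≤1 (no _)  = z≤n

sumTo : (ℕ → ℕ) → ℕ → ℕ
sumTo f zero = 0
sumTo f (suc n) = f 1 + sumTo (f ∘ suc) n

sumTo-cong : ∀ {f g} n → (∀ k → f k ≡ g k) → sumTo f n ≡ sumTo g n
sumTo-cong zero f≗g = refl
sumTo-cong (suc n) f≗g = cong₂ _+_ (f≗g 1) (sumTo-cong n (f≗g ∘ suc))

sumTo-+ : ∀ f m n → sumTo f (m + n) ≡ sumTo f m + sumTo (λ k → f (m + k)) n
sumTo-+ f zero n = refl
sumTo-+ f (suc m) n = trans (cong (_+_ (f 1)) (sumTo-+ (f ∘ suc) m n)) (sym (+-assoc (f 1) _ _))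

sumTo-distrib : ∀ f g n → sumTo (λ k → f k + g k) n ≡ sumTo f n + sumTo g n
sumTo-distrib f g zero = refl
sumTo-distrib f g (suc n) = begin
  f 1 + g 1 + sumTo (λ k → f (suc k) + g (suc k)) n
    ≡⟨ cong (_+_ (f 1 + g 1)) (sumTo-distrib (f ∘ suc) (g ∘ suc) n) ⟩
  f 1 + g 1 + (sumTo (f ∘ suc) n + sumTo (g ∘ suc) n)
    ≡⟨ +-interchange (f 1) (g 1) _ _ ⟩
  f 1 + sumTo (f ∘ suc) n + (g 1 + sumTo (g ∘ suc) n) ∎
  where open ≡-Reasoning

sumTo-vanishing : ∀ f n → (∀ k → 1 ≤ k → k ≤ n → f k ≡ 0) → sumTo f n ≡ 0
sumTo-vanishing f zero f≡0 = refl
sumTo-vanishing f (suc n) f≡0 =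
  cong₂ _+_ (f≡0 1 z<s (s≤s z≤n)) (sumTo-vanishing (f ∘ suc) n (λ k _ k≤n → f≡0 (suc k) z<s (s≤s k≤n)))

sumTo-periodic : ∀ f x → (∀ k → f (x + k) ≡ f k) → ∀ c → sumTo f (c * x) ≡ c * sumTo f x
sumTo-periodic f x periodic zero = refl
sumTo-periodic f x periodic (suc c) =
  trans (sumTo-+ f x (c * x)) (cong (_+_ (sumTo f x)) (trans (sumTo-cong (c * x) periodic) (sumTo-periodic f x periodic c)))

sumTo-suc : ∀ f n → sumTo f (suc n) ≡ sumTo f n + f (suc n)
sumTo-suc f zero = +-comm (f 1) 0
sumTo-suc f (suc n) = trans (cong (_+_ (f 1)) (sumTo-suc (f ∘ suc) n)) (sym (+-assoc (f 1) _ _))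

sumTo-multiples : ∀ q .{{_ : NonZero q}} g → (∀ k → ¬ q ∣ k → g k ≡ 0) → ∀ n →
                  sumTo g (q * n) ≡ sumTo (λ j → g (q * j)) n
sumTo-multiples q g vanishes zero rewrite *-zeroʳ q = refl
sumTo-multiples q@(suc q-1) g vanishes (suc n) = begin
  sumTo g (q * suc n)                          ≡⟨ cong (sumTo g) (*-suc q n) ⟩
  sumTo g (q + q * n)                          ≡⟨ sumTo-+ g q (q * n) ⟩
  sumTo g q + sumTo (λ k → g (q + k)) (q * n)  ≡⟨ cong₂ _+_ first-block rest ⟩
  g (q * 1) + sumTo (λ j → g (q * suc j)) n    ∎
  where
  open ≡-Reasoning
  first-block : sumTo g q ≡ g (q * 1)
  first-block = begin
    sumTo g q             ≡⟨ sumTo-suc g q-1 ⟩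
    sumTo g q-1 + g q     ≡⟨ cong (_+ g q) (sumTo-vanishing g q-1 (λ k 1≤k k≤q-1 →
                               vanishes k (λ q∣k → <⇒≱ (s≤s k≤q-1) (∣⇒≤ {{>-nonZero 1≤k}} q∣k)))) ⟩
    g q                   ≡⟨ cong g (sym (*-identityʳ q)) ⟩
    g (q * 1)             ∎
  rest : sumTo (λ k → g (q + k)) (q * n) ≡ sumTo (λ j → g (q * suc j)) n
  rest = trans (sumTo-multiples q (λ k → g (q + k)) shifted-vanishes n) (sumTo-cong n (λ j → cong g (sym (*-suc q j))))
    where
    shifted-vanishes : ∀ k → ¬ q ∣ k → g (q + k) ≡ 0
    shifted-vanishes k q∤k = vanishes (q + k) (λ q∣q+k → q∤k (∣m+n∣m⇒∣n q∣q+k ∣-refl))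

coprime-∣ˡ : Coprime k x → d ∣ k → Coprime d x
coprime-∣ˡ coprime d∣k (e∣d , e∣x) = coprime (∣-trans e∣d d∣k , e∣x)

coprime-* : Coprime k a → Coprime k b → Coprime k (a * b)
coprime-* k⊥a k⊥b (d∣k , d∣ab) = k⊥b (d∣k , coprime-divisor (coprime-∣ˡ k⊥a d∣k) d∣ab)

coprime-*⁻ʳ : ∀ a → Coprime k (a * b) → Coprime k b
coprime-*⁻ʳ a k⊥ab (d∣k , d∣b) = k⊥ab (d∣k , ∣n⇒∣m*n a d∣b)

coprime-+⁻ : Coprime (x + k) x → Coprime k x
coprime-+⁻ x+k⊥x (d∣k , d∣x) = x+k⊥x (∣m∣n⇒∣m+n d∣x d∣k , d∣x)

¬prime-by-divisor : 1 < d → d < n → d ∣ n → ¬ Prime n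
¬prime-by-divisor 1<d d<n d∣n = composite⇒¬prime (hasNonTrivialDivisor {{n>1⇒nonTrivial 1<d}} d<n d∣n)

prime≢1 : Prime q → q ≢ 1
prime≢1 q-prime q≡1 = ¬prime[1] (subst Prime q≡1 q-prime)

prime∤⇒coprime : Prime q → ¬ q ∣ x → Coprime q x
prime∤⇒coprime q-prime q∤x {d} (d∣q , d∣x) with prime⇒irreducible q-prime d∣q
... | inj₁ d≡1 = d≡1
... | inj₂ refl = contradiction d∣x q∤x

coprimeTo : ℕ → ℕ → ℕ
coprimeTo m k = indicator (coprime? k m)

coprimeTo-cong : (Coprime k m → Coprime k n) → (Coprime k n → Coprime k m) → coprimeTo m k ≡ coprimeTo n k
coprimeTo-cong {k} {m} {n} f g = indicator-cong f g (coprime? k m) (coprime? k n)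

length-filter-applyUpTo : ∀ {P : ℕ → Set} (P? : Decidable P) f n →
  length (filter P? (applyUpTo (f ∘ suc) n)) ≡ sumTo (indicator ∘ P? ∘ f) n
length-filter-applyUpTo P? f zero = refl
length-filter-applyUpTo P? f (suc n) with P? (f 1)
... | yes _ = cong suc (length-filter-applyUpTo P? (f ∘ suc) n)
... | no  _ = length-filter-applyUpTo P? (f ∘ suc) n

φ≡sumTo-coprimeTo : ∀ m → φ m ≡ sumTo (coprimeTo m) m
φ≡sumTo-coprimeTo m = begin
  length (filter gcd≡1? (map suc (upTo m)))    ≡⟨ cong (length ∘ filter gcd≡1?) (map-applyUpTo id suc m) ⟩
  length (filter gcd≡1? (applyUpTo suc m))      ≡⟨ length-filter-applyUpTo gcd≡1? id m ⟩
  sumTo (indicator ∘ gcd≡1?) m                  ≡⟨ sumTo-cong m gcd≡1-coprime ⟩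
  sumTo (coprimeTo m) m                         ∎
  where
  open ≡-Reasoning
  gcd≡1? : ∀ k → Dec (gcd k m ≡ 1)
  gcd≡1? k = gcd k m ≟ 1
  gcd≡1-coprime : ∀ k → indicator (gcd≡1? k) ≡ coprimeTo m k
  gcd≡1-coprime k = indicator-cong gcd≡1⇒coprime coprime⇒gcd≡1 (gcd≡1? k) (coprime? k m)

coprimeTo-periodic : ∀ x k → coprimeTo x (x + k) ≡ coprimeTo x k
coprimeTo-periodic x k = indicator-cong coprime-+⁻ coprime-+ (coprime? (x + k) x) (coprime? k x)

sumTo-coprimeTo-multiple : ∀ x c → sumTo (coprimeTo x) (c * x) ≡ c * φ x
sumTo-coprimeTo-multiple x c = begin
  sumTo (coprimeTo x) (c * x) ≡⟨ sumTo-periodic (coprimeTo x) x (coprimeTo-periodic x) c ⟩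
  c * sumTo (coprimeTo x) x   ≡⟨ cong (c *_) (sym (φ≡sumTo-coprimeTo x)) ⟩
  c * φ x                     ∎
  where open ≡-Reasoning

-- The hypothesis says that every prime factor of c divides x.
φ[c*x]≡c*φ[x] : ∀ c x → (∀ k → Coprime k x → Coprime k c) → φ (c * x) ≡ c * φ x
φ[c*x]≡c*φ[x] c x k⊥x⇒k⊥c = begin
  φ (c * x)                        ≡⟨ φ≡sumTo-coprimeTo (c * x) ⟩
  sumTo (coprimeTo (c * x)) (c * x) ≡⟨ sumTo-cong (c * x) same-coprimes ⟩
  sumTo (coprimeTo x) (c * x)       ≡⟨ sumTo-coprimeTo-multiple x c ⟩
  c * φ x                          ∎
  where
  open ≡-Reasoning
  same-coprimes : ∀ k → coprimeTo (c * x) k ≡ coprimeTo x k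
  same-coprimes k = coprimeTo-cong (coprime-*⁻ʳ c) (λ k⊥x → coprime-* (k⊥x⇒k⊥c k k⊥x) k⊥x)

φ[q*x]+φ[x]≡q*φ[x] : ∀ q x → Prime q → ¬ q ∣ x → φ (q * x) + φ x ≡ q * φ x
φ[q*x]+φ[x]≡q*φ[x] q x q-prime q∤x = begin
  φ (q * x) + φ x                                       ≡⟨ cong₂ _+_ (φ≡sumTo-coprimeTo (q * x)) (sym multiples-of-q) ⟩
  sumTo (coprimeTo (q * x)) (q * x) + sumTo g (q * x)   ≡⟨ sym (sumTo-distrib (coprimeTo (q * x)) g (q * x)) ⟩
  sumTo (λ k → coprimeTo (q * x) k + g k) (q * x)       ≡⟨ sumTo-cong (q * x) split ⟩
  sumTo (coprimeTo x) (q * x)                           ≡⟨ sumTo-coprimeTo-multiple x q ⟩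
  q * φ x                                               ∎
  where
  open ≡-Reasoning
  instance _ = prime⇒nonZero q-prime

  g : ℕ → ℕ
  g k = coprimeTo x k * indicator (q ∣? k)

  split : ∀ k → coprimeTo (q * x) k + g k ≡ coprimeTo x k
  split k with coprime? k (q * x) | q ∣? k | coprime? k x
  ... | yes k⊥qx | yes q∣k | _       = contradiction (k⊥qx (q∣k , m∣m*n x)) (prime≢1 q-prime)
  ... | yes k⊥qx | no _    | no k⊥̸x = ⊥-elim (k⊥̸x (coprime-*⁻ʳ q k⊥qx))
  ... | yes _    | no _    | yes _   = refl
  ... | no k⊥̸qx | yes _   | yes _   = refl
  ... | no k⊥̸qx | no q∤k  | yes k⊥x = ⊥-elim (k⊥̸qx (coprime-* (Coprime.sym (prime∤⇒coprime q-prime q∤k)) k⊥x))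
  ... | no _     | _       | no _    = refl

  q⊥x : Coprime q x
  q⊥x = prime∤⇒coprime q-prime q∤x

  g[q*j]≡coprimeTo : ∀ j → g (q * j) ≡ coprimeTo x j
  g[q*j]≡coprimeTo j with q ∣? (q * j)
  ... | no q∤qj = contradiction (m∣m*n j) q∤qj
  ... | yes _   = trans (*-identityʳ _) (indicator-cong {A = Coprime (q * j) x} {B = Coprime j x}
      (λ qj⊥x → Coprime.sym (coprime-*⁻ʳ q (Coprime.sym qj⊥x)))
      (λ j⊥x → Coprime.sym (coprime-* (Coprime.sym q⊥x) (Coprime.sym j⊥x)))
      (coprime? (q * j) x) (coprime? j x))

  g-vanishes : ∀ k → ¬ q ∣ k → g k ≡ 0
  g-vanishes k q∤k with q ∣? k
  ... | yes q∣k = contradiction q∣k q∤k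
  ... | no _    = *-zeroʳ (coprimeTo x k)

  multiples-of-q : sumTo g (q * x) ≡ φ x
  multiples-of-q = begin
    sumTo g (q * x)              ≡⟨ sumTo-multiples q g g-vanishes x ⟩
    sumTo (λ j → g (q * j)) x    ≡⟨ sumTo-cong x g[q*j]≡coprimeTo ⟩
    sumTo (coprimeTo x) x        ≡⟨ sym (φ≡sumTo-coprimeTo x) ⟩
    φ x                          ∎

m≤n⇒m∣n! : 1 ≤ m → m ≤ n → m ∣ n !
m≤n⇒m∣n! {suc m-1} _ m≤n = ∣-trans (m∣m*n (m-1 !)) (m≤n⇒m!∣n! m≤n)

prime∤! : Prime q → y < q → ¬ q ∣ y !
prime∤! {y = zero}  q-prime _   q∣1   = prime≢1 q-prime (∣1⇒≡1 q∣1)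
prime∤! {y = suc y} q-prime y<q q∣y! with euclidsLemma (suc y) (y !) q-prime q∣y!
... | inj₁ q∣suc-y = <⇒≱ y<q (∣⇒≤ q∣suc-y)
... | inj₂ q∣y!    = prime∤! q-prime (<-trans (n<1+n y) y<q) q∣y!

-- Both factors of a composite n = d e are below n, so they divide (n - 1)!.
coprime-!⇒coprime-suc : ¬ Prime (suc y) → Coprime k (y !) → Coprime k (suc y)
coprime-!⇒coprime-suc {zero}  _      _    (_ , d∣1) = ∣1⇒≡1 d∣1
coprime-!⇒coprime-suc {suc y} {k} ¬pr k⊥y! with ¬prime⇒composite ¬pr
... | composite {d} d<n d∣n =
  subst (Coprime k) (sym (m∣n⇒n≡quotient*m d∣n))
    (coprime-* (coprime-to-smaller (quotient d∣n) (>-nonZero⁻¹ _ {{quotient≢0 d∣n}}) (quotient-< d∣n))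
               (coprime-to-smaller d (<⇒≤ (nonTrivial⇒n>1 d)) d<n))
  where
  coprime-to-smaller : ∀ e → 1 ≤ e → e < suc (suc y) → Coprime k e
  coprime-to-smaller e 1≤e e<n = Coprime.sym (coprime-∣ˡ (Coprime.sym k⊥y!) (m≤n⇒m∣n! 1≤e (≤-pred e<n)))

φ[suc-y!]-composite : ¬ Prime (suc y) → φ (suc y !) ≡ suc y * φ (y !)
φ[suc-y!]-composite {y} ¬pr = φ[c*x]≡c*φ[x] (suc y) (y !) (λ k → coprime-!⇒coprime-suc ¬pr)

φ[suc-y!]-prime : Prime (suc y) → φ (suc y !) ≡ y * φ (y !)
φ[suc-y!]-prime {y} pr = +-cancelʳ-≡ (φ (y !)) _ _
  (trans (φ[q*x]+φ[x]≡q*φ[x] (suc y) (y !) pr (prime∤! pr (n<1+n y))) (+-comm (φ (y !)) _))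

φ!-ratio : ℕ → ℕ
φ!-ratio y with prime? (suc y)
... | yes _ = y
... | no  _ = suc y

φ[suc-y!]≡φ!-ratio*φ[y!] : ∀ y → φ (suc y !) ≡ φ!-ratio y * φ (y !)
φ[suc-y!]≡φ!-ratio*φ[y!] y with prime? (suc y)
... | yes pr  = φ[suc-y!]-prime pr
... | no ¬pr = φ[suc-y!]-composite ¬pr

φ!-ratio≤ : ∀ y → φ!-ratio y ≤ suc y
φ!-ratio≤ y with prime? (suc y)
... | yes _ = n≤1+n y
... | no  _ = ≤-refl

φ!-ratio-pos : ∀ y → 1 ≤ φ!-ratio y
φ!-ratio-pos zero with prime? 1
... | no _ = s≤s z≤n
φ!-ratio-pos (suc y) with prime? (suc (suc y))
... | yes _ = s≤s z≤n
... | no  _ = s≤s z≤n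

n∣φ[n!] : ∀ n → ¬ Prime n → 1 ≤ n → n ∣ φ (n !)
n∣φ[n!] (suc y) ¬pr _ = subst (suc y ∣_) (sym (φ[suc-y!]-composite ¬pr)) (m∣m*n (φ (y !)))

φ-pos : 1 ≤ n → 1 ≤ φ n
φ-pos {suc n-1} _ = subst (1 ≤_) (sym (φ≡sumTo-coprimeTo (suc n-1))) (≤-trans coprimeTo-1 (m≤m+n _ _))
  where
  coprimeTo-1 : 1 ≤ coprimeTo (suc n-1) 1
  coprimeTo-1 with coprime? 1 (suc n-1)
  ... | yes _  = ≤-refl
  ... | no 1⊥̸ = ⊥-elim (1⊥̸ (λ (d∣1 , _) → ∣1⇒≡1 d∣1))

^-monoʳ-∣ : ∀ p → m ≤ n → p ^ m ∣ p ^ n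
^-monoʳ-∣ {m} {n} p m≤n = divides (p ^ (n ∸ m)) (begin
  p ^ n              ≡⟨ cong (p ^_) (sym (m∸n+n≡m m≤n)) ⟩
  p ^ (n ∸ m + m)    ≡⟨ ^-distribˡ-+-* p (n ∸ m) m ⟩
  p ^ (n ∸ m) * p ^ m ∎)
  where open ≡-Reasoning

coprime-^ˡ : ∀ k → Coprime p a → Coprime (p ^ k) a
coprime-^ˡ zero    _   (d∣1 , _) = ∣1⇒≡1 d∣1
coprime-^ˡ (suc k) p⊥a = Coprime.sym (coprime-* (Coprime.sym p⊥a) (Coprime.sym (coprime-^ˡ k p⊥a)))

prime^-∣-coprime : Prime p → ¬ p ∣ a → p ^ k ∣ a * b → p ^ k ∣ b
prime^-∣-coprime {k = k} p-prime p∤a = coprime-divisor (coprime-^ˡ k (prime∤⇒coprime p-prime p∤a))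

prime^-∣-exact : Prime p → ¬ p * p ∣ a → p ∣ a → p ^ suc k ∣ a * b → p ^ k ∣ b
prime^-∣-exact {p} {k = k} {b} p-prime p²∤a (divides s refl) pᵏ⁺¹∣spb =
  prime^-∣-coprime {k = k} p-prime p∤s (*-cancelˡ-∣ p (subst (p ^ suc k ∣_) (*-assoc-comm s p b) pᵏ⁺¹∣spb))
  where
  instance _ = prime⇒nonZero p-prime
  p∤s : ¬ p ∣ s
  p∤s p∣s = p²∤a (*-monoˡ-∣ p p∣s)
  *-assoc-comm : ∀ s p b → s * p * b ≡ p * (s * b)
  *-assoc-comm = solve-∀

∏< : (ℕ → ℕ) → ℕ → ℕ
∏< f zero    = 1
∏< f (suc n) = f n * ∏< f n

φ[n!]≡∏<φ!-ratio : ∀ n → φ (n !) ≡ ∏< φ!-ratio n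
φ[n!]≡∏<φ!-ratio zero    = refl
φ[n!]≡∏<φ!-ratio (suc n) = trans (φ[suc-y!]≡φ!-ratio*φ[y!] n) (cong (φ!-ratio n *_) (φ[n!]≡∏<φ!-ratio n))

∏<-mono-∣ : ∀ f → m ≤ n → ∏< f m ∣ ∏< f n
∏<-mono-∣ {n = zero}  f z≤n = ∣-refl
∏<-mono-∣ {n = suc n} f m≤1+n with m≤n⇒m<n∨m≡n m≤1+n
... | inj₁ m<1+n = ∣-trans (∏<-mono-∣ f (≤-pred m<1+n)) (n∣m*n (f n))
... | inj₂ refl  = ∣-refl

countAtMost : List ℕ → ℕ → ℕ
countAtMost []      c = 0
countAtMost (s ∷ S) c = indicator (s ≤? c) + countAtMost S c

countAtMost-mono : ∀ S c → countAtMost S c ≤ countAtMost S (suc c)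
countAtMost-mono []      c = z≤n
countAtMost-mono (s ∷ S) c = +-mono-≤ (indicator-mono m≤n⇒m≤1+n (s ≤? c) (s ≤? suc c)) (countAtMost-mono S c)

countAtMost-∈ : ∀ S c → suc c ∈ S → countAtMost S c < countAtMost S (suc c)
countAtMost-∈ (s ∷ S) c (here refl) with s ≤? c | s ≤? s
... | yes s≤c | _      = contradiction s≤c (<⇒≱ (n<1+n c))
... | no _    | yes _  = s≤s (countAtMost-mono S c)
... | no _    | no s≰s = contradiction ≤-refl s≰s
countAtMost-∈ (s ∷ S) c (there s∈S) =
  +-mono-≤-< (indicator-mono m≤n⇒m≤1+n (s ≤? c) (s ≤? suc c)) (countAtMost-∈ S c s∈S)

countAtMost≤length : ∀ S c → countAtMost S c ≤ length S
countAtMost≤length []      c = z≤n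
countAtMost≤length (s ∷ S) c = +-mono-≤ (indicator≤1 (s ≤? c)) (countAtMost≤length S c)

∏<-pow-∤ : ∀ f → Prime p → ∀ S c → (∀ y → y < c → ¬ p * p ∣ f y) → (∀ y → y < c → p ∣ f y → suc y ∈ S) →
           ¬ p ^ suc (countAtMost S c) ∣ ∏< f c
∏<-pow-∤ f p-prime S zero _ _ p∣1 = prime≢1 p-prime (∣1⇒≡1 (∣-trans (m∣m*n _) p∣1))
∏<-pow-∤ {p} f p-prime S (suc c) p²∤f positions =
  step (∏<-pow-∤ f p-prime S c (λ y → p²∤f y ∘ m<n⇒m<1+n) (λ y → positions y ∘ m<n⇒m<1+n))
  where
  step : ¬ p ^ suc (countAtMost S c) ∣ ∏< f c → ¬ p ^ suc (countAtMost S (suc c)) ∣ f c * ∏< f c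
  step below pᵏ∣∏ with p ∣? f c
  ... | no p∤fc  = below (∣-trans (^-monoʳ-∣ p (s≤s (countAtMost-mono S c)))
                                  (prime^-∣-coprime {k = suc (countAtMost S (suc c))} p-prime p∤fc pᵏ∣∏))
  ... | yes p∣fc = below (prime^-∣-exact {k = suc (countAtMost S c)} p-prime (p²∤f c ≤-refl) p∣fc
                           (∣-trans (^-monoʳ-∣ p (s≤s (countAtMost-∈ S c (positions c ≤-refl p∣fc)))) pᵏ∣∏))

φ!-mono-∣ : m ≤ n → φ (m !) ∣ φ (n !)
φ!-mono-∣ {m} {n} m≤n = subst₂ _∣_ (sym (φ[n!]≡∏<φ!-ratio m)) (sym (φ[n!]≡∏<φ!-ratio n)) (∏<-mono-∣ φ!-ratio m≤n)

φ!-pow-∣-composite : p ^ k ∣ φ (z !) → z < x → ¬ Prime x → p ∣ x → p ^ suc k ∣ φ (x !)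
φ!-pow-∣-composite {p} {k} {x = suc y} pᵏ∣ z<x ¬pr p∣x =
  subst (p ^ suc k ∣_) (sym (φ[suc-y!]-composite ¬pr)) (*-pres-∣ p∣x (∣-trans pᵏ∣ (φ!-mono-∣ (≤-pred z<x))))

φ!-pow-∣-prime : p ^ k ∣ φ (z !) → z ≤ y → Prime (suc y) → p ∣ y → p ^ suc k ∣ φ (suc y !)
φ!-pow-∣-prime {p} {k} pᵏ∣ z≤y pr p∣y =
  subst (p ^ suc k ∣_) (sym (φ[suc-y!]-prime pr)) (*-pres-∣ p∣y (∣-trans pᵏ∣ (φ!-mono-∣ z≤y)))

primeRows : List ℕ
primeRows = 2 ∷ 6 ∷ 8 ∷ []

module _ {p} (p-prime : Prime p) (18≤p : 18 ≤ p)
         (2p+1-prime : Prime (suc (2 * p))) (6p+1-prime : Prime (suc (6 * p))) (8p+1-prime : Prime (suc (8 * p)))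
         (only-primeRows : ∀ j → j < 18 → Prime (suc (j * p)) → j ∈ primeRows) where

  private
    instance _ = prime⇒nonZero p-prime

    1<p : 1 < p
    1<p = ≤-trans (s≤s (s≤s z≤n)) 18≤p

    jp<j′p : ∀ {j j′} → j < j′ → j * p < j′ * p
    jp<j′p = *-monoˡ-< p

    jp+1<[1+j]p : ∀ j → suc (j * p) < suc j * p
    jp+1<[1+j]p j = +-monoˡ-< (j * p) 1<p

  p^10∣φ[[8p+1]!] : p ^ 10 ∣ φ (suc (8 * p) !)
  p^10∣φ[[8p+1]!] = at-8p+1
    where
    at-multiple : ∀ k {z} j → 2 ≤ j → p ^ k ∣ φ (z !) → z < j * p → p ^ suc k ∣ φ ((j * p) !)
    at-multiple k j 2≤j pᵏ∣ z<jp = φ!-pow-∣-composite {k = k} pᵏ∣ z<jp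
      (¬prime-by-divisor 1<p (subst (_< j * p) (*-identityˡ p) (jp<j′p 2≤j)) (n∣m*n j)) (n∣m*n j)
    at-prime : ∀ k {z} j → Prime (suc (j * p)) → p ^ k ∣ φ (z !) → z ≤ j * p → p ^ suc k ∣ φ (suc (j * p) !)
    at-prime k j pr pᵏ∣ z≤jp = φ!-pow-∣-prime {k = k} pᵏ∣ z≤jp pr (n∣m*n j)

    at-2p : p ^ 1 ∣ φ ((2 * p) !)
    at-2p = at-multiple 0 2 ≤-refl (1∣ _) (jp<j′p {0} {2} z<s)
    at-2p+1 : p ^ 2 ∣ φ (suc (2 * p) !)
    at-2p+1 = at-prime 1 2 2p+1-prime at-2p ≤-refl
    at-3p : p ^ 3 ∣ φ ((3 * p) !)
    at-3p = at-multiple 2 3 (n≤1+n 2) at-2p+1 (jp+1<[1+j]p 2)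
    at-4p : p ^ 4 ∣ φ ((4 * p) !)
    at-4p = at-multiple 3 4 (m≤n+m 2 2) at-3p (jp<j′p {3} ≤-refl)
    at-5p : p ^ 5 ∣ φ ((5 * p) !)
    at-5p = at-multiple 4 5 (m≤n+m 2 3) at-4p (jp<j′p {4} ≤-refl)
    at-6p : p ^ 6 ∣ φ ((6 * p) !)
    at-6p = at-multiple 5 6 (m≤n+m 2 4) at-5p (jp<j′p {5} ≤-refl)
    at-6p+1 : p ^ 7 ∣ φ (suc (6 * p) !)
    at-6p+1 = at-prime 6 6 6p+1-prime at-6p ≤-refl
    at-7p : p ^ 8 ∣ φ ((7 * p) !)
    at-7p = at-multiple 7 7 (m≤n+m 2 5) at-6p+1 (jp+1<[1+j]p 6)
    at-8p : p ^ 9 ∣ φ ((8 * p) !)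
    at-8p = at-multiple 8 8 (m≤n+m 2 6) at-7p (jp<j′p {7} ≤-refl)
    at-8p+1 : p ^ 10 ∣ φ (suc (8 * p) !)
    at-8p+1 = at-prime 9 8 8p+1-prime at-8p ≤-refl

  exceptional : List ℕ
  exceptional = applyUpTo (λ i → (2 + i) * p) 16 ++ map (λ j → suc (j * p)) primeRows

  private
    p∣φ!-ratio⇒exceptional : ∀ y → suc y < 18 * p → p ∣ φ!-ratio y → suc y ∈ exceptional
    p∣φ!-ratio⇒exceptional y y<18p p∣ratio with prime? (suc y)
    ... | yes pr = from-prime-row p∣ratio
      where
      from-prime-row : p ∣ y → suc y ∈ exceptional
      from-prime-row (divides j refl) = ∈-++⁺ʳ (applyUpTo (λ i → (2 + i) * p) 16) (∈-map⁺ (λ j → suc (j * p))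
        (only-primeRows j (*-cancelʳ-< p j 18 (<-trans (n<1+n (j * p)) y<18p)) pr))
    ... | no ¬pr = from-multiple p∣ratio
      where
      from-multiple : p ∣ suc y → suc y ∈ exceptional
      from-multiple (divides 1 y+1≡p+0) = contradiction (subst Prime (sym (trans y+1≡p+0 (+-identityʳ p))) p-prime) ¬pr
      from-multiple (divides (suc (suc i)) y+1≡[2+i]p) = subst (_∈ exceptional) (sym y+1≡[2+i]p)
        (∈-++⁺ˡ (∈-applyUpTo⁺ (λ i → (2 + i) * p)
          (≤-pred (≤-pred (*-cancelʳ-< p (2 + i) 18 (subst (_< 18 * p) y+1≡[2+i]p y<18p))))))

    p²∤φ!-ratio : ∀ y → suc y < 18 * p → ¬ p * p ∣ φ!-ratio y
    p²∤φ!-ratio y y<18p p²∣ratio = <⇒≱ (≤-<-trans (φ!-ratio≤ y) y<18p)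
      (≤-trans (*-monoˡ-≤ p 18≤p) (∣⇒≤ {{>-nonZero (φ!-ratio-pos y)}} p²∣ratio))

  p^20∤φ[c!] : c < 18 * p → ¬ p ^ 20 ∣ φ (c !)
  p^20∤φ[c!] {c} c<18p p²⁰∣φ[c!] = ∏<-pow-∤ φ!-ratio p-prime exceptional c
    (λ y y<c → p²∤φ!-ratio y (≤-<-trans y<c c<18p))
    (λ y y<c → p∣φ!-ratio⇒exceptional y (≤-<-trans y<c c<18p))
    (∣-trans (^-monoʳ-∣ p (s≤s (countAtMost≤length exceptional c)))
             (subst (p ^ 20 ∣_) (φ[n!]≡∏<φ!-ratio c) p²⁰∣φ[c!]))

  c[8p+1,8p+1]≥18p : IsC (suc (8 * p)) (suc (8 * p)) c → 18 * p ≤ c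
  c[8p+1,8p+1]≥18p {c} (_ , D∣φ[c!] , _) = ≮⇒≥ λ c<18p → p^20∤φ[c!] c<18p (∣-trans p²⁰∣D D∣φ[c!])
    where
    p²⁰∣D : p ^ 20 ∣ φ (suc (8 * p) !) * φ (suc (8 * p) !)
    p²⁰∣D = subst (_∣ φ (suc (8 * p) !) * φ (suc (8 * p) !)) (sym (^-distribˡ-+-* p 10 10))
                  (*-pres-∣ p^10∣φ[[8p+1]!] p^10∣φ[[8p+1]!])

least-witness : ∀ {P : ℕ → Set} → Decidable P → ∀ n → P n → ∃[ c ] (P c × (∀ c′ → c′ < c → ¬ P c′))
least-witness {P} P? n Pn = search n 0 (λ _ ()) refl
  where
  search : ∀ k c → (∀ c′ → c′ < c → ¬ P c′) → c + k ≡ n → ∃[ c ] (P c × (∀ c′ → c′ < c → ¬ P c′))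
  search k c below c+k≡n with P? c
  ... | yes Pc = c , Pc , below
  search zero    c below c+0≡n | no ¬Pc = contradiction (subst P (sym (trans (sym (+-identityʳ c)) c+0≡n)) Pn) ¬Pc
  search (suc k) c below c+k≡n | no ¬Pc = search k (suc c) below′ (trans (sym (+-suc c k)) c+k≡n)
    where
    below′ : ∀ c′ → c′ < suc c → ¬ P c′
    below′ c′ c′<1+c with m≤n⇒m<n∨m≡n (≤-pred c′<1+c)
    ... | inj₁ c′<c = below c′ c′<c
    ... | inj₂ refl = ¬Pc

c-exists : ∀ a b → ∃[ c ] IsC a b c
c-exists a b with least-witness (λ c → D ∣? φ (suc c !)) (4 * D) D∣φ[[1+4D]!]
  where
  D = φ (a !) * φ (b !)
  1≤D : 1 ≤ D
  1≤D = *-mono-≤ (φ-pos (1≤n! a)) (φ-pos (1≤n! b))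
  D∣φ[[1+4D]!] : D ∣ φ (suc (4 * D) !)
  D∣φ[[1+4D]!] = ∣-trans (∣-trans (n∣m*n 4) (n∣φ[n!] (4 * D) ¬prime[4D] 1≤4D)) (φ!-mono-∣ (n≤1+n (4 * D)))
    where
    1≤4D : 1 ≤ 4 * D
    1≤4D = *-mono-≤ (s≤s (z≤n {3})) 1≤D
    ¬prime[4D] : ¬ Prime (4 * D)
    ¬prime[4D] = ¬prime-by-divisor sz<ss (*-mono-≤ {3} {4} (n≤1+n 3) 1≤D) (∣-trans (divides 2 refl) (m∣m*n D))
... | c , D∣φ[[1+c]!] , minimal = suc c , s≤s z≤n , D∣φ[[1+c]!] , smaller
  where
  smaller : ∀ c′ → 1 ≤ c′ → c′ < suc c → ¬ φ (a !) * φ (b !) ∣ φ (c′ !)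
  smaller (suc c′) _ (s≤s c′<c) = minimal c′ c′<c

toℚᵘ-/ : ∀ i n .{{_ : NonZero n}} → ℚ.toℚᵘ (i / n) ℚᵘ.≃ (i ℚᵘ./ n)
toℚᵘ-/ i (suc n) = ℚP.toℚᵘ-fromℚᵘ (i ℚᵘ./ suc n)

p≤r+q⇒p-q≤r : ∀ {p q r : ℚ} → p ℚ.≤ r ℚ.+ q → p - q ℚ.≤ r
p≤r+q⇒p-q≤r {p} {q} {r} p≤r+q = ℚP.≤-trans (ℚP.+-monoˡ-≤ (ℚ.- q) p≤r+q) (ℚP.≤-reflexive (begin
  r ℚ.+ q ℚ.+ ℚ.- q     ≡⟨ ℚP.+-assoc r q (ℚ.- q) ⟩
  r ℚ.+ (q ℚ.+ ℚ.- q)   ≡⟨ cong (r ℚ.+_) (ℚP.+-inverseʳ q) ⟩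
  r ℚ.+ 0ℚ              ≡⟨ ℚP.+-identityʳ r ⟩
  r                     ∎))
  where open ≡-Reasoning

[a/b]-[c/d]≤e/f : ∀ a b c d e f .{{_ : NonZero b}} .{{_ : NonZero d}} .{{_ : NonZero f}} →
                  a * (f * d) ≤ (e * d + c * f) * b → (+ a / b) - (+ c / d) ℚ.≤ + e / f
[a/b]-[c/d]≤e/f a b@(suc _) c d@(suc _) e f@(suc _) cross = p≤r+q⇒p-q≤r (ℚP.toℚᵘ-cancel-≤
  (ℚᵘP.≤-respʳ-≃ (ℚᵘP.≃-sym sum≃) (ℚᵘP.≤-respˡ-≃ (ℚᵘP.≃-sym (toℚᵘ-/ (+ a) b)) unnormalised)))
  where
  sum≃ : ℚ.toℚᵘ (+ e / f ℚ.+ + c / d) ℚᵘ.≃ (+ e ℚᵘ./ f ℚᵘ.+ + c ℚᵘ./ d)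
  sum≃ = ℚᵘP.≃-trans (ℚP.toℚᵘ-homo-+ (+ e / f) (+ c / d)) (ℚᵘP.+-cong (toℚᵘ-/ (+ e) f) (toℚᵘ-/ (+ c) d))
  unnormalised : (+ a ℚᵘ./ b) ℚᵘ.≤ (+ e ℚᵘ./ f ℚᵘ.+ + c ℚᵘ./ d)
  unnormalised = ℚᵘ.*≤* (subst₂ ℤ._≤_ lhs rhs (ℤ.+≤+ cross))
    where
    lhs : + (a * (f * d)) ≡ + a ℤ.* + (f * d)
    lhs = ℤP.pos-* a (f * d)
    rhs : + ((e * d + c * f) * b) ≡ (+ e ℤ.* + d ℤ.+ + c ℤ.* + f) ℤ.* + b
    rhs = begin
      + ((e * d + c * f) * b)                  ≡⟨ ℤP.pos-* (e * d + c * f) b ⟩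
      + (e * d + c * f) ℤ.* + b                ≡⟨ cong (ℤ._* + b) (ℤP.pos-+ (e * d) (c * f)) ⟩
      (+ (e * d) ℤ.+ + (c * f)) ℤ.* + b        ≡⟨ cong (ℤ._* + b) (cong₂ ℤ._+_ (ℤP.pos-* e d) (ℤP.pos-* c f)) ⟩
      (+ e ℤ.* + d ℤ.+ + c ℤ.* + f) ℤ.* + b    ∎
      where open ≡-Reasoning

9/8-[9/8n]≤c/2n : ∀ p c → 18 * p ≤ c →
                  (+ 9 / 8) - (+ 9 / (8 * suc (8 * p))) ℚ.≤ (+ c / (suc (8 * p) + suc (8 * p)))
9/8-[9/8n]≤c/2n p c 18p≤c = [a/b]-[c/d]≤e/f 9 8 9 (8 * n₀) c (n₀ + n₀) (subst (lhs ≤_)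
  (trans (cleared p (c ∸ 18 * p)) (cong (λ c → (c * (8 * n₀) + 9 * (n₀ + n₀)) * 8) (m+[n∸m]≡n 18p≤c)))
  (m≤m+n lhs _))
  where
  n₀ = suc (8 * p)
  lhs = 9 * ((n₀ + n₀) * (8 * n₀))
  -- with c = 18 p + e, the two sides of the cleared inequality differ by 64 e (8p + 1).
  cleared : ∀ p e → 9 * ((suc (8 * p) + suc (8 * p)) * (8 * suc (8 * p))) + 64 * e * suc (8 * p)
                  ≡ ((18 * p + e) * (8 * suc (8 * p)) + 9 * (suc (8 * p) + suc (8 * p))) * 8
  cleared = solve-∀

-- P t ≡ 1 (mod 2), 2 (mod 3), 1 (mod 5), 4 (mod 7): this makes j P t + 1 composite for the
-- j < 18 other than 2, 6, 8, witnessed by a divisor d ∈ {2, 3, 5, 7} of 11 j + 1.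
P : ℕ → ℕ
P t = 11 + 210 * t

row-value : ∀ j t → suc (j * P t) ≡ suc (11 * j) + 210 * j * t
row-value = expanded
  where
  expanded : ∀ j t → suc (j * (11 + 210 * t)) ≡ suc (11 * j) + 210 * j * t
  expanded = solve-∀

¬prime-row : ∀ {d t} j → 1 ≤ t → 1 ≤ j → 1 < d → d ∣ 210 → d ∣ suc (11 * j) → ¬ Prime (suc (j * P t))
¬prime-row {d} {t} j 1≤t 1≤j 1<d d∣210 d∣11j+1 = ¬prime-by-divisor 1<d d<jP+1
  (subst (d ∣_) (sym (row-value j t)) (∣m∣n⇒∣m+n d∣11j+1 (∣-trans d∣210 (∣-trans (m∣m*n j) (m∣m*n t)))))
  where
  d<jP+1 : d < suc (j * P t)
  d<jP+1 = s≤s (begin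
    d           ≤⟨ ∣⇒≤ d∣210 ⟩
    210         ≤⟨ m≤n+m 210 11 ⟩
    11 + 210    ≤⟨ +-monoʳ-≤ 11 (*-monoʳ-≤ 210 1≤t) ⟩
    P t         ≤⟨ m≤n*m (P t) j {{>-nonZero 1≤j}} ⟩
    j * P t     ∎)
    where open ≤-Reasoning

private
  2∣210 : 2 ∣ 210
  2∣210 = divides 105 refl
  3∣210 : 3 ∣ 210
  3∣210 = divides 70 refl
  5∣210 : 5 ∣ 210
  5∣210 = divides 42 refl
  7∣210 : 7 ∣ 210
  7∣210 = divides 30 refl

P-only-primeRows : ∀ {t} → 1 ≤ t → ∀ j → j < 18 → Prime (suc (j * P t)) → j ∈ primeRows
P-only-primeRows 1≤t 0  _ pr = contradiction pr ¬prime[1]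
P-only-primeRows 1≤t 1  _ pr = contradiction pr (¬prime-row 1  1≤t z<s sz<ss 2∣210 (divides 6 refl))
P-only-primeRows 1≤t 2  _ _  = here refl
P-only-primeRows 1≤t 3  _ pr = contradiction pr (¬prime-row 3  1≤t z<s sz<ss 2∣210 (divides 17 refl))
P-only-primeRows 1≤t 4  _ pr = contradiction pr (¬prime-row 4  1≤t z<s sz<ss 3∣210 (divides 15 refl))
P-only-primeRows 1≤t 5  _ pr = contradiction pr (¬prime-row 5  1≤t z<s sz<ss 2∣210 (divides 28 refl))
P-only-primeRows 1≤t 6  _ _  = there (here refl)
P-only-primeRows 1≤t 7  _ pr = contradiction pr (¬prime-row 7  1≤t z<s sz<ss 2∣210 (divides 39 refl))
P-only-primeRows 1≤t 8  _ _  = there (there (here refl))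
P-only-primeRows 1≤t 9  _ pr = contradiction pr (¬prime-row 9  1≤t z<s sz<ss 2∣210 (divides 50 refl))
P-only-primeRows 1≤t 10 _ pr = contradiction pr (¬prime-row 10 1≤t z<s sz<ss 3∣210 (divides 37 refl))
P-only-primeRows 1≤t 11 _ pr = contradiction pr (¬prime-row 11 1≤t z<s sz<ss 2∣210 (divides 61 refl))
P-only-primeRows 1≤t 12 _ pr = contradiction pr (¬prime-row 12 1≤t z<s sz<ss 7∣210 (divides 19 refl))
P-only-primeRows 1≤t 13 _ pr = contradiction pr (¬prime-row 13 1≤t z<s sz<ss 2∣210 (divides 72 refl))
P-only-primeRows 1≤t 14 _ pr = contradiction pr (¬prime-row 14 1≤t z<s sz<ss 5∣210 (divides 31 refl))
P-only-primeRows 1≤t 15 _ pr = contradiction pr (¬prime-row 15 1≤t z<s sz<ss 2∣210 (divides 83 refl))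
P-only-primeRows 1≤t 16 _ pr = contradiction pr (¬prime-row 16 1≤t z<s sz<ss 3∣210 (divides 59 refl))
P-only-primeRows 1≤t 17 _ pr = contradiction pr (¬prime-row 17 1≤t z<s sz<ss 2∣210 (divides 94 refl))
P-only-primeRows 1≤t (suc (suc (suc (suc (suc (suc (suc (suc (suc (suc (suc (suc (suc (suc (suc (suc (suc (suc j)))))))))))))))))) j<18 _ =
  contradiction j<18 (≤⇒≯ (m≤m+n 18 j))

-- offsets i + slopes i * t are P t, 2 P t + 1, 6 P t + 1 and 8 P t + 1.
offsets : Fin 4 → ℤ
offsets zero                   = + 11
offsets (suc zero)             = + 23
offsets (suc (suc zero))       = + 67
offsets (suc (suc (suc zero))) = + 89

slopes : Fin 4 → ℕ
slopes zero                   = 210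
slopes (suc zero)             = 420
slopes (suc (suc zero))       = 1260
slopes (suc (suc (suc zero))) = 1680

slopes-pos : ∀ i → 1 ≤ slopes i
slopes-pos zero                   = z<s
slopes-pos (suc zero)             = z<s
slopes-pos (suc (suc zero))       = z<s
slopes-pos (suc (suc (suc zero))) = z<s

-- A common prime divisor of the values 1508639 at t = 0 and 229823670089 at t = 1 would divide
-- 862262 · 229823670089 − 131355624121 · 1508639 = 1.
admissible : ¬ (∃[ q ] (Prime q × (∀ t → t < q → (+ q) ℤD.∣ prodℤ 4 (λ i → offsets i ℤ.+ (+ slopes i) ℤ.* (+ t)))))
admissible (q , q-prime , q∣values) = prime≢1 q-prime (∣1⇒≡1 q∣1)
  where
  1<q : 1 < q
  1<q = nonTrivial⇒n>1 q {{prime⇒nonTrivial q-prime}}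
  q∣value₀ : q ∣ 1508639
  q∣value₀ = q∣values 0 (<-trans z<s 1<q)
  q∣value₁ : q ∣ 229823670089
  q∣value₁ = q∣values 1 1<q
  q∣1 : q ∣ 1
  q∣1 = ∣m+n∣m⇒∣n (∣n⇒∣m*n 131355624121 q∣value₀) (∣n⇒∣m*n 862262 q∣value₁)

prime-value : ∀ a b t → ∃[ q ] (Prime q × + a ℤ.+ + b ℤ.* + t ≡ + q) → Prime (a + b * t)
prime-value a b t (q , q-prime , a+bt≡q) = subst Prime (sym (ℤP.+-injective (begin
  + (a + b * t)        ≡⟨ ℤP.pos-+ a (b * t) ⟩
  + a ℤ.+ + (b * t)    ≡⟨ cong (ℤ._+_ (+ a)) (ℤP.pos-* b t) ⟩
  + a ℤ.+ + b ℤ.* + t  ≡⟨ a+bt≡q ⟩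
  + q                  ∎))) q-prime
  where open ≡-Reasoning

c[8P+1,8P+1]≥18P : ∀ t → 1 ≤ t → (∀ i → ∃[ q ] (Prime q × offsets i ℤ.+ (+ slopes i) ℤ.* (+ t) ≡ + q)) →
                   IsC (suc (8 * P t)) (suc (8 * P t)) c → 18 * P t ≤ c
c[8P+1,8P+1]≥18P t 1≤t values = c[8p+1,8p+1]≥18p {P t}
  (prime-value 11 210 t (values zero)) 18≤P
  (row-prime 2 (prime-value 23 420 t (values (suc zero))))
  (row-prime 6 (prime-value 67 1260 t (values (suc (suc zero)))))
  (row-prime 8 (prime-value 89 1680 t (values (suc (suc (suc zero))))))
  (P-only-primeRows 1≤t)
  where
  18≤P : 18 ≤ P t
  18≤P = ≤-trans (m≤m+n 18 203) (+-monoʳ-≤ 11 (*-monoʳ-≤ 210 1≤t))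
  row-prime : ∀ j → Prime (suc (11 * j) + 210 * j * t) → Prime (suc (j * P t))
  row-prime j = subst Prime (sym (row-value j t))

theorem1p5 : Dickson →
    ∀ N → ∃[ m ] (N ≤ m × ∃[ c ] (IsC (suc m) (suc m) c ×
    ((+ 9 / 8) - (+ 9 / (8 * suc m))) ℚ.≤ (+ c / (suc m + suc m))))
theorem1p5 dickson N =
  let t , N<t , values = dickson 4 offsets slopes slopes-pos admissible N
      c , c-isC = c-exists (suc (8 * P t)) (suc (8 * P t))
  in 8 * P t , N≤8P t N<t , c , c-isC ,
     9/8-[9/8n]≤c/2n (P t) c (c[8P+1,8P+1]≥18P t (≤-trans z<s N<t) values c-isC)
  where
  N≤8P : ∀ t → N < t → N ≤ 8 * P t
  N≤8P t N<t = ≤-trans (<⇒≤ N<t) (≤-trans (m≤n*m t 210) (≤-trans (m≤n+m (210 * t) 11) (m≤n*m (P t) 8)))
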